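{- Let $p$ be any one of the following six mesh patterns $(12,R)$: $R_1=\{0,1,2\}^2$; $R_2=\{(0,1),(1,0),(1,1),(1,2),(2,1)\}$; $R_3=\{(0,1),(0,2),(1,0),(1,1),(1,2),(2,0),(2,1)\}$; $R_4=\{(0,0),(0,1),(1,0),(1,1),(1,2),(2,1),(2,2)\}$; $R_5=\{(0,0),(0,1),(1,0),(1,1),(1,2),(2,1)\}$; $R_6=\{(0,1),(0,2),(1,0),(1,1),(1,2),(2,1)\}$. Then $\sum_{n\ge0}t^n\sum_{\sigma\in K_n}u^{p(\sigma)}=A(t)$.
   Context: A permutation $\sigma=\sigma_1\cdots\sigma_n$ of $\{1,\dots,n\}$ is a king permutation if $|\sigma_{i+1}-\sigma_i|>1$ for all $1\le i\le n-1$. $K_n$ is the set of king permutations of length $n$ ($K_0$ = the empty permutation) and $A(t)=\sum_{n\ge0}|K_n|t^n$ (known to equal $\sum_{n\ge0}n!\,t^n(1-t)^n/(1+t)^n$). For a mesh pattern $p=(12,R)$ with $R\subseteq\{0,1,2\}^2$, an occurrence of $p$ in $\sigma\in S_n$ is a pair of positions $i_1<i_2$ with $\sigma_{i_1}<\sigma_{i_2}$ such that for every $(x,y)\in R$ there is no position $m$ with $i_x<m<i_{x+1}$ and $v_y<\sigma_m<v_{y+1}$, where $i_0=0$, $i_3=n+1$, $v_0=0$, $v_1=\sigma_{i_1}$, $v_2=\sigma_{i_2}$, $v_3=n+1$ (the first coordinate of a box indexes positions, the second values). $p(\sigma)$ denotes the number of occurrences of $p$ in $\sigma$. -}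

module Defs where

open import Data.Nat using (ℕ; zero; suc; _+_; _<ᵇ_; _≡ᵇ_; ∣_-_∣)
open import Data.Bool using (Bool; true; false; _∧_; not; if_then_else_)
open import Data.List using (List; []; _∷_; map; length; filterᵇ; concatMap; upTo)
open import Data.Bool.ListAction using (all; any)
open import Data.Product using (_×_; _,_)
open import Data.Fin using (Fin; zero; suc)

-- Permutations are words (lists) over {1,…,n}, values 1-indexed.

insertions : ℕ → List ℕ → List (List ℕ)
insertions x [] = (x ∷ []) ∷ []
insertions x (y ∷ ys) = (x ∷ y ∷ ys) ∷ map (y ∷_) (insertions x ys)

perms : ℕ → List (List ℕ)
perms zero = [] ∷ []
perms (suc n) = concatMap (insertions (suc n)) (perms n)

isKing : List ℕ → Bool
isKing [] = true
isKing (x ∷ []) = true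
isKing (x ∷ y ∷ r) = (1 <ᵇ ∣ x - y ∣) ∧ isKing (y ∷ r)

kings : ℕ → List (List ℕ)
kings n = filterᵇ isKing (perms n)

-- σ_i for 1 ≤ i ≤ length σ (1-indexed; 0 outside range)
at : List ℕ → ℕ → ℕ
at [] _ = 0
at (x ∷ xs) zero = 0
at (x ∷ xs) (suc zero) = x
at (x ∷ xs) (suc (suc k)) = at xs (suc k)

positions : ℕ → List ℕ
positions n = map suc (upTo n)

bound : ℕ → ℕ → ℕ → ℕ → ℕ
bound n a b zero = 0
bound n a b (suc zero) = a
bound n a b (suc (suc zero)) = b
bound n a b (suc (suc (suc _))) = suc n

boxEmpty : List ℕ → ℕ → ℕ → ℕ × ℕ → Bool
boxEmpty σ i₁ i₂ (x , y) =
  not (any (λ m → (bound n i₁ i₂ x <ᵇ m) ∧ (m <ᵇ bound n i₁ i₂ (suc x))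
                ∧ (bound n v₁ v₂ y <ᵇ at σ m) ∧ (at σ m <ᵇ bound n v₁ v₂ (suc y)))
           (positions n))
  where
    n = length σ
    v₁ = at σ i₁
    v₂ = at σ i₂

isOcc : List (ℕ × ℕ) → List ℕ → ℕ → ℕ → Bool
isOcc R σ i₁ i₂ = (i₁ <ᵇ i₂) ∧ (at σ i₁ <ᵇ at σ i₂) ∧ all (boxEmpty σ i₁ i₂) R

occurrences : List (ℕ × ℕ) → List ℕ → ℕ
occurrences R σ =
  length (concatMap (λ i₁ → filterᵇ (isOcc R σ i₁) (positions (length σ)))
                    (positions (length σ)))

-- coefficient of t^n u^k in Σ_n t^n Σ_{σ∈K_n} u^{p(σ)}
genCoeff : List (ℕ × ℕ) → ℕ → ℕ → ℕ
genCoeff R n k = length (filterᵇ (λ σ → occurrences R σ ≡ᵇ k) (kings n))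

-- coefficient of t^n u^k in A(t) = Σ_n |K_n| t^n (independent of u)
ACoeff : ℕ → ℕ → ℕ
ACoeff n k = if k ≡ᵇ 0 then length (kings n) else 0

R₁ R₂ R₃ R₄ R₅ R₆ : List (ℕ × ℕ)
R₁ = (0 , 0) ∷ (0 , 1) ∷ (0 , 2) ∷ (1 , 0) ∷ (1 , 1) ∷ (1 , 2) ∷ (2 , 0) ∷ (2 , 1) ∷ (2 , 2) ∷ []
R₂ = (0 , 1) ∷ (1 , 0) ∷ (1 , 1) ∷ (1 , 2) ∷ (2 , 1) ∷ []
R₃ = (0 , 1) ∷ (0 , 2) ∷ (1 , 0) ∷ (1 , 1) ∷ (1 , 2) ∷ (2 , 0) ∷ (2 , 1) ∷ []
R₄ = (0 , 0) ∷ (0 , 1) ∷ (1 , 0) ∷ (1 , 1) ∷ (1 , 2) ∷ (2 , 1) ∷ (2 , 2) ∷ []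
R₅ = (0 , 0) ∷ (0 , 1) ∷ (1 , 0) ∷ (1 , 1) ∷ (1 , 2) ∷ (2 , 1) ∷ []
R₆ = (0 , 1) ∷ (0 , 2) ∷ (1 , 0) ∷ (1 , 1) ∷ (1 , 2) ∷ (2 , 1) ∷ []

shading : Fin 6 → List (ℕ × ℕ)
shading zero = R₁
shading (suc zero) = R₂
shading (suc (suc zero)) = R₃
shading (suc (suc (suc zero))) = R₄
shading (suc (suc (suc (suc zero)))) = R₅
shading (suc (suc (suc (suc (suc zero))))) = R₆

{-# OPTIONS --safe #-}
module Submission where

-- Each of the six shadings contains the cross {(1,0),(1,1),(1,2),(0,1),(2,1)}. Let σᵢ σⱼ be an
-- occurrence with the cross empty in a permutation σ. If j > i + 1, the point (i + 1, σᵢ₊₁) lies in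
-- the middle column; if σⱼ > σᵢ + 1, the point with value σᵢ + 1 lies in the middle row. Hence
-- j = i + 1 and σⱼ = σᵢ + 1, which a king permutation forbids: p vanishes on every Kₙ, and the
-- series collapses to Σ |Kₙ| tⁿ = A(t).

open import Defs
open import Data.Nat using (ℕ)
open import Data.Fin using (Fin)
open import Relation.Binary.PropositionalEquality using (_≡_)

open import Data.Bool using (T; _∧_; if_then_else_)
open import Data.Bool.Properties using (T-∧; T-not-≡)
open import Data.Empty using (⊥; ⊥-elim)
open import Data.Fin.Properties using (all?)
open import Data.List using (List; []; _∷_; [_]; _++_; map; length; filterᵇ; concatMap; upTo)
open import Data.List.Properties using (filter-all; filter-none; length-map; length-upTo; upTo-∷ʳ; map-++)
open import Data.List.Membership.Propositional using (_∈_; lose; find)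
open import Data.List.Membership.Propositional.Properties
  using (∈-map⁻; ∈-map⁺; ∈-upTo⁺; ∈-upTo⁻; ∈-concatMap⁻; ∈-filter⁻)
open import Data.List.Relation.Unary.Any using (here; there)
open import Data.List.Relation.Unary.Any.Properties using (any⁺)
open import Data.List.Relation.Unary.All as All using (All; []; _∷_)
open import Data.List.Relation.Unary.All.Properties using (all⁺)
open import Data.List.Relation.Unary.AllPairs using (_∷_)
open import Data.List.Relation.Unary.Unique.Propositional using (Unique)
open import Data.List.Relation.Unary.Unique.Propositional.Properties as Unique using (upTo⁺)
open import Data.List.Relation.Binary.Permutation.Propositional
  using (_↭_; ↭-refl; ↭-prep; ↭-swap; ↭-trans; ↭-sym; ↭-reflexive; ↭⇒↭ₛ)
open import Data.List.Relation.Binary.Permutation.Propositional.Properties using (∈-resp-↭; ↭-length; ∷↭∷ʳ)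
open import Data.List.Relation.Binary.Subset.Propositional using (_⊆_)
open import Data.Nat using (zero; suc; _<_; _≤_; _≡ᵇ_; ∣_-_∣; z≤n; s≤s)
open import Data.Nat.Properties
  using ( _≟_; suc-injective; <ᵇ⇒<; <⇒<ᵇ; ≡ᵇ⇒≡; ≡⇒≡ᵇ; <-cmp; <-irrefl; <-trans; ≤-trans; <⇒≤; ≤-pred
        ; m≤n⇒m<n∨m≡n; n<1+n; 1+n≢n; 0≢1+n)
open import Data.Product using (_×_; _,_; ∃; proj₁; proj₂)
open import Data.Product.Properties using (≡-dec)
open import Data.Sum using (inj₁; inj₂)
open import Function using (_∘_; Equivalence)
open import Relation.Binary using (tri<; tri≈; tri>)
open import Relation.Binary.PropositionalEquality using (_≢_; refl; sym; trans; cong; cong₂; subst; setoid)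
open import Relation.Nullary using (¬_; contradiction)
open import Relation.Nullary.Decidable using (T?; toWitness)

open import Data.List.Relation.Binary.Permutation.Setoid.Properties (setoid ℕ) using (Unique-resp-↭)
open import Data.List.Relation.Binary.Subset.DecPropositional (≡-dec _≟_ _≟_) using (_⊆?_)

∈-positions⁺ : ∀ {n k} → k < n → suc k ∈ positions n
∈-positions⁺ k<n = ∈-map⁺ suc (∈-upTo⁺ k<n)

∈-positions⁻ : ∀ {n i} → i ∈ positions n → ∃ λ k → i ≡ suc k × k < n
∈-positions⁻ i∈ with k , k∈ , refl ← ∈-map⁻ suc i∈ = k , refl , ∈-upTo⁻ k∈

positions-unique : ∀ n → Unique (positions n)
positions-unique n = Unique.map⁺ suc-injective (upTo⁺ n)

∷-positions↭ : ∀ n → suc n ∷ positions n ↭ positions (suc n)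
∷-positions↭ n = ↭-trans (∷↭∷ʳ (suc n) (positions n))
  (↭-reflexive (trans (sym (map-++ suc (upTo n) [ n ])) (cong (map suc) (upTo-∷ʳ n))))

length-positions : ∀ n → length (positions n) ≡ n
length-positions n = trans (length-map suc (upTo n)) (length-upTo n)

insertions-↭ : ∀ (x : ℕ) ys {τ} → τ ∈ insertions x ys → τ ↭ x ∷ ys
insertions-↭ x [] (here refl) = ↭-refl
insertions-↭ x (y ∷ ys) (here refl) = ↭-refl
insertions-↭ x (y ∷ ys) (there τ∈) with τ′ , τ′∈ , refl ← ∈-map⁻ (y ∷_) τ∈ =
  ↭-trans (↭-prep y (insertions-↭ x ys τ′∈)) (↭-swap y x ↭-refl)

∈-perms⇒↭ : ∀ n {σ} → σ ∈ perms n → σ ↭ positions n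
∈-perms⇒↭ zero (here refl) = ↭-refl
∈-perms⇒↭ (suc n) σ∈
  with τ , τ∈ , σ∈ins ← find (∈-concatMap⁻ (insertions (suc n)) {xs = perms n} σ∈) =
  ↭-trans (insertions-↭ (suc n) τ σ∈ins)
          (↭-trans (↭-prep (suc n) (∈-perms⇒↭ n τ∈)) (∷-positions↭ n))

↭-positions-length : ∀ {σ n} → σ ↭ positions n → σ ↭ positions (length σ)
↭-positions-length {σ} σ↭ =
  subst (λ m → σ ↭ positions m) (sym (trans (↭-length σ↭) (length-positions _))) σ↭

at-∈ : ∀ {σ k} → k < length σ → at σ (suc k) ∈ σ
at-∈ {x ∷ xs} {zero} _ = here refl
at-∈ {x ∷ xs} {suc k} (s≤s k<n) = there (at-∈ k<n)

∈⇒at : ∀ {σ v} → v ∈ σ → ∃ λ k → k < length σ × at σ (suc k) ≡ v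
∈⇒at (here refl) = zero , s≤s z≤n , refl
∈⇒at (there v∈) with k , k<n , eq ← ∈⇒at v∈ = suc k , s≤s k<n , eq

at-injective : ∀ {σ k l} → Unique σ → k < length σ → l < length σ →
               at σ (suc k) ≡ at σ (suc l) → k ≡ l
at-injective {k = zero} {zero} _ _ _ _ = refl
at-injective {k = zero} {suc l} (x∉ ∷ _) _ (s≤s l<n) eq = contradiction eq (All.lookup x∉ (at-∈ l<n))
at-injective {k = suc k} {zero} (x∉ ∷ _) (s≤s k<n) _ eq = contradiction (sym eq) (All.lookup x∉ (at-∈ k<n))
at-injective {k = suc k} {suc l} (_ ∷ u) (s≤s k<n) (s≤s l<n) eq = cong suc (at-injective u k<n l<n eq)

isKing⇒apart : ∀ {σ k} → T (isKing σ) → suc k < length σ →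
               1 < ∣ at σ (suc k) - at σ (suc (suc k)) ∣
isKing⇒apart {_ ∷ []} {zero} _ (s≤s ())
isKing⇒apart {x ∷ y ∷ _} {zero} king _ = <ᵇ⇒< 1 _ (proj₁ (Equivalence.to T-∧ king))
isKing⇒apart {x ∷ y ∷ _} {suc k} king (s≤s k<n) = isKing⇒apart (proj₂ (Equivalence.to T-∧ king)) k<n

∣n-1+n∣≡1 : ∀ n → ∣ n - suc n ∣ ≡ 1
∣n-1+n∣≡1 zero = refl
∣n-1+n∣≡1 (suc n) = ∣n-1+n∣≡1 n

isKing⇒noConsecutiveFactor : ∀ {σ k} → T (isKing σ) → suc k < length σ →
                             at σ (suc (suc k)) ≢ suc (at σ (suc k))
isKing⇒noConsecutiveFactor {σ} {k} king 1+k<n eq =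
  <-irrefl (sym (∣n-1+n∣≡1 (at σ (suc k))))
           (subst (λ v → 1 < ∣ at σ (suc k) - v ∣) eq (isKing⇒apart {σ} king 1+k<n))

Inside : ℕ → ℕ → ℕ → ℕ → ℕ → Set
Inside n a b z w = bound n a b z < w × w < bound n a b (suc z)

∃-Inside : ∀ {n a b w} → 0 < w → w ≤ n → w ≢ a → w ≢ b → ∃ λ z → z ≤ 2 × Inside n a b z w
∃-Inside {_} {a} {b} {w} 0<w w≤n w≢a w≢b with <-cmp w a
... | tri< w<a _ _ = 0 , z≤n , 0<w , w<a
... | tri≈ _ w≡a _ = contradiction w≡a w≢a
... | tri> _ _ a<w with <-cmp w b
...   | tri< w<b _ _ = 1 , s≤s z≤n , a<w , w<b
...   | tri≈ _ w≡b _ = contradiction w≡b w≢b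
...   | tri> _ _ b<w = 2 , s≤s (s≤s z≤n) , b<w , s≤s w≤n

boxEmpty⁻ : ∀ σ i₁ i₂ x y {m} → T (boxEmpty σ i₁ i₂ (x , y)) → m ∈ positions (length σ) →
            Inside (length σ) i₁ i₂ x m → Inside (length σ) (at σ i₁) (at σ i₂) y (at σ m) → ⊥
boxEmpty⁻ σ i₁ i₂ x y empty m∈ (l₁ , l₂) (l₃ , l₄) =
  subst T (Equivalence.to T-not-≡ empty) (any⁺ _ (lose m∈ (<⇒<ᵇ l₁ & <⇒<ᵇ l₂ & <⇒<ᵇ l₃ & <⇒<ᵇ l₄)))
  where
  infixr 5 _&_
  _&_ : ∀ {a b} → T a → T b → T (a ∧ b)
  ta & tb = Equivalence.from T-∧ (ta , tb)

isOcc⁻ : ∀ {R σ i₁ i₂} → T (isOcc R σ i₁ i₂) →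
         i₁ < i₂ × at σ i₁ < at σ i₂ × All (T ∘ boxEmpty σ i₁ i₂) R
isOcc⁻ {R} {σ} {i₁} {i₂} occ with i₁<i₂ , rest ← Equivalence.to T-∧ occ
                              with v₁<v₂ , empty ← Equivalence.to T-∧ rest =
  <ᵇ⇒< i₁ i₂ i₁<i₂ , <ᵇ⇒< (at σ i₁) (at σ i₂) v₁<v₂ , all⁺ _ R empty

cross : List (ℕ × ℕ)
cross = (1 , 0) ∷ (1 , 1) ∷ (1 , 2) ∷ (0 , 1) ∷ (2 , 1) ∷ []

middleColumn∈cross : ∀ {z} → z ≤ 2 → (1 , z) ∈ cross
middleColumn∈cross z≤n = here refl
middleColumn∈cross (s≤s z≤n) = there (here refl)
middleColumn∈cross (s≤s (s≤s z≤n)) = there (there (here refl))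

middleRow∈cross : ∀ {z} → z ≤ 2 → (z , 1) ∈ cross
middleRow∈cross z≤n = there (there (there (here refl)))
middleRow∈cross (s≤s z≤n) = there (here refl)
middleRow∈cross (s≤s (s≤s z≤n)) = there (there (there (there (here refl))))

cross⊆shading : ∀ j → cross ⊆ shading j
cross⊆shading = toWitness {a? = all? (λ j → cross ⊆? shading j)} _

module Permutation {σ : List ℕ} (σ↭ : σ ↭ positions (length σ)) where

  private
    N = length σ

  unique : Unique σ
  unique = Unique-resp-↭ (↭⇒↭ₛ (↭-sym σ↭)) (positions-unique N)

  at-range : ∀ {k} → k < N → 0 < at σ (suc k) × at σ (suc k) ≤ N
  at-range k<N with j , eq , j<N ← ∈-positions⁻ (∈-resp-↭ σ↭ (at-∈ k<N)) =
    subst (λ v → 0 < v × v ≤ N) (sym eq) (s≤s z≤n , j<N)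

  at-surjective : ∀ {v} → 0 < v → v ≤ N → ∃ λ k → k < N × at σ (suc k) ≡ v
  at-surjective (s≤s z≤n) v≤N = ∈⇒at (∈-resp-↭ (↭-sym σ↭) (∈-positions⁺ v≤N))

  columnEmpty⇒adjacent : ∀ {a b} → a < N → b < N → a < b →
                         (∀ {y} → y ≤ 2 → T (boxEmpty σ (suc a) (suc b) (1 , y))) → b ≡ suc a
  columnEmpty⇒adjacent {a} {b} a<N b<N a<b empty with m≤n⇒m<n∨m≡n a<b
  ... | inj₂ 1+a≡b = sym 1+a≡b
  ... | inj₁ 1+a<b = ⊥-elim (notInColumn (∃-Inside 0<w w≤N w≢v₁ w≢v₂))
    where
    1+a<N : suc a < N
    1+a<N = <-trans 1+a<b b<N
    w = at σ (suc (suc a))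
    0<w = proj₁ (at-range 1+a<N)
    w≤N = proj₂ (at-range 1+a<N)
    w≢v₁ : w ≢ at σ (suc a)
    w≢v₁ eq = 1+n≢n (at-injective unique 1+a<N a<N eq)
    w≢v₂ : w ≢ at σ (suc b)
    w≢v₂ eq = <-irrefl (at-injective unique 1+a<N b<N eq) 1+a<b
    notInColumn : (∃ λ y → y ≤ 2 × Inside N (at σ (suc a)) (at σ (suc b)) y w) → ⊥
    notInColumn (y , y≤2 , w-inside) =
      boxEmpty⁻ σ (suc a) (suc b) 1 y (empty y≤2) (∈-positions⁺ 1+a<N)
        (n<1+n (suc a) , s≤s 1+a<b) w-inside

  rowEmpty⇒consecutive : ∀ {a b} → a < N → b < N → at σ (suc a) < at σ (suc b) →
                         (∀ {x} → x ≤ 2 → T (boxEmpty σ (suc a) (suc b) (x , 1))) →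
                         at σ (suc b) ≡ suc (at σ (suc a))
  rowEmpty⇒consecutive {a} {b} a<N b<N v₁<v₂ empty with m≤n⇒m<n∨m≡n v₁<v₂
  ... | inj₂ 1+v₁≡v₂ = sym 1+v₁≡v₂
  ... | inj₁ 1+v₁<v₂ = ⊥-elim (notInRow (at-surjective (s≤s z≤n) 1+v₁≤N))
    where
    v₁ = at σ (suc a)
    v₂ = at σ (suc b)
    1+v₁≤N : suc v₁ ≤ N
    1+v₁≤N = ≤-trans (<⇒≤ 1+v₁<v₂) (proj₂ (at-range b<N))
    notInRow : (∃ λ k → k < N × at σ (suc k) ≡ suc v₁) → ⊥
    notInRow (k , k<N , σk≡1+v₁) = notInBox (∃-Inside (s≤s z≤n) k<N k≢a k≢b)
      where
      k≢a : suc k ≢ suc a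
      k≢a eq = 1+n≢n (sym (trans (cong (at σ) (sym eq)) σk≡1+v₁))
      k≢b : suc k ≢ suc b
      k≢b eq = <-irrefl (trans (sym σk≡1+v₁) (cong (at σ) eq)) 1+v₁<v₂
      notInBox : (∃ λ x → x ≤ 2 × Inside N (suc a) (suc b) x (suc k)) → ⊥
      notInBox (x , x≤2 , k-inside) =
        boxEmpty⁻ σ (suc a) (suc b) x 1 (empty x≤2) (∈-positions⁺ k<N) k-inside
        (subst (Inside N v₁ v₂ 1) (sym σk≡1+v₁) (n<1+n v₁ , 1+v₁<v₂))

  noOccurrence : ∀ {R i₁ i₂} → cross ⊆ R → T (isKing σ) →
                 i₁ ∈ positions N → i₂ ∈ positions N → ¬ T (isOcc R σ i₁ i₂)
  noOccurrence {R} cross⊆R king i₁∈ i₂∈ occ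
    with a , refl , a<N ← ∈-positions⁻ i₁∈
    with b , refl , b<N ← ∈-positions⁻ i₂∈
    with i₁<i₂ , v₁<v₂ , empty ← isOcc⁻ {R} {σ} occ
    with refl ← columnEmpty⇒adjacent a<N b<N (≤-pred i₁<i₂)
                  (λ y≤2 → All.lookup empty (cross⊆R (middleColumn∈cross y≤2))) =
    isKing⇒noConsecutiveFactor {σ} king b<N
      (rowEmpty⇒consecutive a<N b<N v₁<v₂ (λ x≤2 → All.lookup empty (cross⊆R (middleRow∈cross x≤2))))

concatMap-[] : ∀ {A B : Set} {f : A → List B} {xs} → All (λ x → f x ≡ []) xs → concatMap f xs ≡ []
concatMap-[] [] = refl
concatMap-[] (eq ∷ eqs) = cong₂ _++_ eq (concatMap-[] eqs)

isKing⇒occurrences≡0 : ∀ {R σ} → cross ⊆ R → σ ↭ positions (length σ) → T (isKing σ) →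
                       occurrences R σ ≡ 0
isKing⇒occurrences≡0 {R} {σ} cross⊆R σ↭ king =
  cong length (concatMap-[] (All.tabulate λ i₁∈ →
    filter-none (T? ∘ isOcc R σ _) (All.tabulate (noOccurrence cross⊆R king i₁∈))))
  where open Permutation σ↭

length-filter-≡ᵇ-zeros : ∀ {A : Set} (f : A → ℕ) {xs} k → All (λ x → f x ≡ 0) xs →
                         length (filterᵇ (λ x → f x ≡ᵇ k) xs) ≡ (if k ≡ᵇ 0 then length xs else 0)
length-filter-≡ᵇ-zeros f zero zeros =
  cong length (filter-all (T? ∘ _) (All.map (λ {x} eq → ≡⇒≡ᵇ (f x) 0 eq) zeros))
length-filter-≡ᵇ-zeros f (suc k) zeros =
  cong length (filter-none (T? ∘ _)
    (All.map (λ {x} eq t → 0≢1+n (trans (sym eq) (≡ᵇ⇒≡ (f x) (suc k) t))) zeros))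

theorem3p1 : (j : Fin 6) (n k : ℕ) → genCoeff (shading j) n k ≡ ACoeff n k
theorem3p1 j n k = length-filter-≡ᵇ-zeros (occurrences (shading j)) k (All.tabulate kingsAvoid)
  where
  kingsAvoid : ∀ {σ} → σ ∈ kings n → occurrences (shading j) σ ≡ 0
  kingsAvoid σ∈ with σ∈perms , king ← ∈-filter⁻ (T? ∘ isKing) σ∈ =
    isKing⇒occurrences≡0 (cross⊆shading j) (↭-positions-length (∈-perms⇒↭ n σ∈perms)) king
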